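{- For every closed term $s:\mathrm{State}$, the pair $(\Vdash_T^s,\Vdash^s)$ satisfies: (MR1) if $r\Vdash^s A$ then $\mathrm{unit}\,r\Vdash_T^s A$; (MR2) if $r\Vdash^s B\to C$ then $\mathrm{star}\,r\,p\Vdash_T^s C$ for every closed $p:\|B\|$ with $p\Vdash_T^s B$; (MR3) if $p\Vdash_T^s B$ and $q\Vdash_T^s C$ then $\mathrm{merge}\,p\,q\Vdash_T^s B\wedge C$. That is, $\Vdash_T^s$ is a monadic realizability relation for the interactive realizability monad.
   Context: System $T'$: types generated from atomic types including $\mathrm{Unit}$, $\mathrm{Nat}$, $\mathrm{State}$, $\mathrm{Ex}$ by $\to,\times,+$; terms of the simply typed $\lambda$-calculus over constants including $\mathrm{unit}:\mathrm{Unit}$, $\mathrm{pair}$, $\pi_1,\pi_2$, $\mathrm{inl},\mathrm{inr}$, $\mathrm{case}:X+Y\to(X\to Z)\to(Y\to Z)\to Z$, $0$, $S$, bounded course-of-value recursors, and a constant $\mathrm{merge}_{\mathrm{Ex}}:\mathrm{Ex}\to\mathrm{Ex}\to\mathrm{Ex}$, with the usual $\beta$, projection and case reductions; $t\leadsto u$ means $t$ reduces to $u$ in finitely many steps; $\bar n$ is the numeral of $n$. A relation "$e$ properly extends $s$" between closed terms $e:\mathrm{Ex}$ and $s:\mathrm{State}$ is given (intended meaning: the partial function on finite knowledge states denoted by $e$ is defined at the state denoted by $s$ and yields a strict extension of it), and it is assumed that (EX): if $e_1$ and $e_2$ both properly extend $s$ then $\mathrm{merge}_{\mathrm{Ex}}e_1e_2$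 properly extends $s$. Interactive realizability monad: $TX=\mathrm{State}\to(X+\mathrm{Ex})$; $\mathrm{unit}_X=\lambda x{:}X.\lambda\_{:}\mathrm{State}.\mathrm{inl}\,x$; $\mathrm{star}_{X,Y}=\lambda f{:}X\to TY.\lambda m{:}TX.\lambda s{:}\mathrm{State}.\mathrm{case}(ms)(\lambda x{:}X.fxs)\,\mathrm{inr}$; $\mathrm{merge}_{X,Y}=\lambda m{:}TX.\lambda n{:}TY.\lambda s{:}\mathrm{State}.\mathrm{case}(ms)(\lambda x{:}X.\mathrm{case}(ns)(\lambda y{:}Y.\mathrm{inl}(\mathrm{pair}\,x\,y))\,\mathrm{inr})(\lambda e_1{:}\mathrm{Ex}.\mathrm{case}(ns)(\lambda\_{:}Y.\mathrm{inr}\,e_1)(\lambda e_2{:}\mathrm{Ex}.\mathrm{inr}(\mathrm{merge}_{\mathrm{Ex}}e_1e_2)))$. Formulas of Heyting Arithmetic built from atomic formulas (including $\bot$, never true) with $\wedge,\vee,\to,\forall,\exists$; arithmetic terms are $T'$-terms of type Nat. Types: $|P|=\mathrm{Unit}$, $|B\wedge C|=|B|\times|C|$, $|B\vee C|=|B|+|C|$, $|\exists xB|=\mathrm{Nat}\times|B|$, $|B\to C|=|B|\to\|C\|$, $|\forall xB|=\mathrm{Nat}\to\|B\|$, $\|A\|=T|A|$. For a closed $s:\mathrm{State}$, relations between closed terms and closed formulas are defined by simultaneous recursion on the formula: $r\Vdash_T^s A$ (for $r:\|A\|$) iff either $rs\leadsto\mathrm{inl}\,r'$ for some $r'$ with $r'\Vdash^s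 A$, or $rs\leadsto\mathrm{inr}\,e$ for some $e$ that properly extends $s$; and for $r:|A|$: $r\Vdash^sP$ ($P$ atomic) iff $r\leadsto\mathrm{unit}$ and $P$ is true; $r\Vdash^sB\wedge C$ iff $\pi_1r\Vdash^sB$ and $\pi_2r\Vdash^sC$; $r\Vdash^sB\vee C$ iff $r\leadsto\mathrm{inl}\,a$ with $a\Vdash^sB$ or $r\leadsto\mathrm{inr}\,b$ with $b\Vdash^sC$; $r\Vdash^sB\to C$ iff $rp\Vdash_T^sC$ for all $p:|B|$ with $p\Vdash^sB$; $r\Vdash^s\forall xB$ iff $r\bar n\Vdash^s_TB[x:=\bar n]$ for all $n$; $r\Vdash^s\exists xB$ iff $\pi_2r\Vdash^sB[x:=\pi_1r]$. -}

module Defs where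

open import Data.Nat using (ℕ; zero; suc)
open import Data.List using (List; []; _∷_; replicate)
open import Data.Vec using (Vec)
open import Data.Vec.Relation.Binary.Pointwise.Inductive using (Pointwise)
open import Data.Product using (Σ; Σ-syntax; _×_; _,_)
open import Data.Sum using (_⊎_)
open import Data.Empty using (⊥)
open import Relation.Binary.Construct.Closure.ReflexiveTransitive using (Star)
open import Relation.Binary.Construct.Closure.Equivalence using (EqClosure)

infixr 7 _⇒_
infixr 8 _⊗_ _⊕_

data Ty (B : Set) : Set where
  UnitT NatT StateT ExT : Ty B
  baseT : B → Ty B
  _⇒_ _⊗_ _⊕_ : Ty B → Ty B → Ty B

-- A signature: further atomic types and further constants (e.g. the
-- bounded course-of-value recursors and any other constants of T').
record Sig : Set₁ where
  field
    Base  : Set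
    Extra : Ty Base → Set

module _ (σ : Sig) where
  open Sig σ

  Type : Set
  Type = Ty Base

  Ctx : Set
  Ctx = List Type

  infix 4 _∋_
  data _∋_ : Ctx → Type → Set where
    Z : ∀ {Γ A} → (A ∷ Γ) ∋ A
    S : ∀ {Γ A B} → Γ ∋ A → (B ∷ Γ) ∋ A

  data Const : Type → Set where
    c-unit  : Const UnitT
    c-pair  : ∀ {X Y} → Const (X ⇒ Y ⇒ X ⊗ Y)
    c-π₁    : ∀ {X Y} → Const (X ⊗ Y ⇒ X)
    c-π₂    : ∀ {X Y} → Const (X ⊗ Y ⇒ Y)
    c-inl   : ∀ {X Y} → Const (X ⇒ X ⊕ Y)
    c-inr   : ∀ {X Y} → Const (Y ⇒ X ⊕ Y)
    c-case  : ∀ {X Y Z} → Const (X ⊕ Y ⇒ (X ⇒ Z) ⇒ (Y ⇒ Z) ⇒ Z)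
    c-zero  : Const NatT
    c-suc   : Const (NatT ⇒ NatT)
    c-mergeEx : Const (ExT ⇒ ExT ⇒ ExT)
    c-extra : ∀ {X} → Extra X → Const X

  infixl 7 _·_
  data Tm (Γ : Ctx) : Type → Set where
    var : ∀ {A} → Γ ∋ A → Tm Γ A
    ƛ_  : ∀ {A B} → Tm (A ∷ Γ) B → Tm Γ (A ⇒ B)
    _·_ : ∀ {A B} → Tm Γ (A ⇒ B) → Tm Γ A → Tm Γ B
    con : ∀ {A} → Const A → Tm Γ A

  CTm : Type → Set
  CTm = Tm []

  Ren : Ctx → Ctx → Set
  Ren Γ Δ = ∀ {A} → Γ ∋ A → Δ ∋ A

  Sub : Ctx → Ctx → Set
  Sub Γ Δ = ∀ {A} → Γ ∋ A → Tm Δ A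

  ext : ∀ {Γ Δ B} → Ren Γ Δ → Ren (B ∷ Γ) (B ∷ Δ)
  ext ρ Z     = Z
  ext ρ (S x) = S (ρ x)

  rename : ∀ {Γ Δ} → Ren Γ Δ → ∀ {A} → Tm Γ A → Tm Δ A
  rename ρ (var x) = var (ρ x)
  rename ρ (ƛ t)   = ƛ rename (ext ρ) t
  rename ρ (t · u) = rename ρ t · rename ρ u
  rename ρ (con c) = con c

  exts : ∀ {Γ Δ B} → Sub Γ Δ → Sub (B ∷ Γ) (B ∷ Δ)
  exts σ' Z     = var Z
  exts σ' (S x) = rename S (σ' x)

  subst : ∀ {Γ Δ} → Sub Γ Δ → ∀ {A} → Tm Γ A → Tm Δ A
  subst σ' (var x) = σ' x
  subst σ' (ƛ t)   = ƛ subst (exts σ') t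
  subst σ' (t · u) = subst σ' t · subst σ' u
  subst σ' (con c) = con c

  _,,_ : ∀ {Γ Δ B} → Sub Γ Δ → Tm Δ B → Sub (B ∷ Γ) Δ
  (σ' ,, t) Z     = t
  (σ' ,, t) (S x) = σ' x

  _[_] : ∀ {Γ A B} → Tm (B ∷ Γ) A → Tm Γ B → Tm Γ A
  t [ u ] = subst (var ,, u) t

  -- Extra root reduction rules (e.g. for the recursors) are a parameter.
  RuleSet : Set₁
  RuleSet = ∀ {Γ A} → Tm Γ A → Tm Γ A → Set

  module _ (Rule : RuleSet) where

    infix 2 _⟶_
    data _⟶_ {Γ} : ∀ {A} → Tm Γ A → Tm Γ A → Set where
      β     : ∀ {A B} {t : Tm (A ∷ Γ) B} {u} → (ƛ t) · u ⟶ t [ u ]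
      β-π₁  : ∀ {X Y} {a : Tm Γ X} {b : Tm Γ Y} → con c-π₁ · (con c-pair · a · b) ⟶ a
      β-π₂  : ∀ {X Y} {a : Tm Γ X} {b : Tm Γ Y} → con c-π₂ · (con c-pair · a · b) ⟶ b
      β-inl : ∀ {X Y Z} {a : Tm Γ X} {f : Tm Γ (X ⇒ Z)} {g : Tm Γ (Y ⇒ Z)} →
              con c-case · (con c-inl · a) · f · g ⟶ f · a
      β-inr : ∀ {X Y Z} {b : Tm Γ Y} {f : Tm Γ (X ⇒ Z)} {g : Tm Γ (Y ⇒ Z)} →
              con c-case · (con c-inr · b) · f · g ⟶ g · b
      rule  : ∀ {A} {t u : Tm Γ A} → Rule t u → t ⟶ u
      ξ-ƛ   : ∀ {A B} {t t' : Tm (A ∷ Γ) B} → t ⟶ t' → ƛ t ⟶ ƛ t'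
      ξ-·₁  : ∀ {A B} {t t' : Tm Γ (A ⇒ B)} {u} → t ⟶ t' → t · u ⟶ t' · u
      ξ-·₂  : ∀ {A B} {t : Tm Γ (A ⇒ B)} {u u'} → u ⟶ u' → t · u ⟶ t · u'

    infix 2 _⇝_
    _⇝_ : ∀ {Γ A} → Tm Γ A → Tm Γ A → Set
    _⇝_ = Star _⟶_

    infix 2 _≃_
    _≃_ : ∀ {Γ A} → Tm Γ A → Tm Γ A → Set
    _≃_ = EqClosure _⟶_

  numeral : ∀ {Γ} → ℕ → Tm Γ NatT
  numeral zero    = con c-zero
  numeral (suc n) = con c-suc · numeral n

  Tmon : Type → Type
  Tmon X = StateT ⇒ X ⊕ ExT

  unitM : ∀ {X} → CTm (X ⇒ Tmon X)
  unitM = ƛ ƛ (con c-inl · var (S Z))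

  starM : ∀ {X Y} → CTm ((X ⇒ Tmon Y) ⇒ Tmon X ⇒ Tmon Y)
  starM = ƛ ƛ ƛ (con c-case · (var (S Z) · var Z)
                   · (ƛ (var (S (S (S Z))) · var Z · var (S Z)))
                   · con c-inr)

  mergeM : ∀ {X Y} → CTm (Tmon X ⇒ Tmon Y ⇒ Tmon (X ⊗ Y))
  mergeM {X} {Y} = ƛ ƛ ƛ
    (con c-case · (var (S (S Z)) · var Z)
      · (ƛ (con c-case · (var (S (S Z)) · var (S Z))
             · (ƛ (con c-inl · (con c-pair · var (S Z) · var Z)))
             · con c-inr))
      · (ƛ (con c-case · (var (S (S Z)) · var (S Z))
             · (ƛ (con c-inr · var (S Z)))
             · (ƛ (con c-inr · (con c-mergeEx · var (S Z) · var Z))))))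

  -- Formulas of Heyting Arithmetic with n free (number) variables;
  -- arithmetic terms are T'-terms of type Nat in context Nat^n.
  NCtx : ℕ → Ctx
  NCtx n = replicate n NatT

  data Fm (n : ℕ) : Set₁ where
    ⊥ᶠ   : Fm n
    atom : ∀ {k} → (Vec ℕ k → Set) → Vec (Tm (NCtx n) NatT) k → Fm n
    _∧ᶠ_ _∨ᶠ_ _→ᶠ_ : Fm n → Fm n → Fm n
    ∀ᶠ ∃ᶠ : Fm (suc n) → Fm n

  ∣_∣ : ∀ {n} → Fm n → Type
  ∣ ⊥ᶠ ∣       = UnitT
  ∣ atom P ts ∣ = UnitT
  ∣ B ∧ᶠ C ∣   = ∣ B ∣ ⊗ ∣ C ∣
  ∣ B ∨ᶠ C ∣   = ∣ B ∣ ⊕ ∣ C ∣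
  ∣ B →ᶠ C ∣   = ∣ B ∣ ⇒ Tmon ∣ C ∣
  ∣ ∀ᶠ B ∣     = NatT ⇒ Tmon ∣ B ∣
  ∣ ∃ᶠ B ∣     = NatT ⊗ ∣ B ∣

  ∥_∥ : ∀ {n} → Fm n → Type
  ∥ A ∥ = Tmon ∣ A ∣

  -- closing environments: assignment of closed Nat terms to the free
  -- variables (A with environment ρ stands for the closed formula A[ρ])
  Env : ℕ → Set
  Env n = Sub (NCtx n) []

  emptyEnv : Env 0
  emptyEnv ()

  module _ (Rule : RuleSet)
           (_properlyExtends_ : CTm ExT → CTm StateT → Set) where

    -- truth of closed atomic formulas: the argument terms denote
    -- natural numbers (are convertible to numerals) satisfying P
    AtomTrue : ∀ {n k} → (Vec ℕ k → Set) → Vec (Tm (NCtx n) NatT) k → Env n → Set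
    AtomTrue P ts ρ =
      Σ[ ns ∈ Vec ℕ _ ] Pointwise (λ t m → _≃_ Rule (subst ρ t) (numeral m)) ts ns × P ns

    mutual
      Real : (s : CTm StateT) → ∀ {n} (A : Fm n) → Env n → CTm ∣ A ∣ → Set
      Real s ⊥ᶠ ρ r         = _⇝_ Rule r (con c-unit) × ⊥
      Real s (atom P ts) ρ r = _⇝_ Rule r (con c-unit) × AtomTrue P ts ρ
      Real s (B ∧ᶠ C) ρ r   = Real s B ρ (con c-π₁ · r) × Real s C ρ (con c-π₂ · r)
      Real s (B ∨ᶠ C) ρ r   =
          (Σ[ a ∈ CTm ∣ B ∣ ] (_⇝_ Rule r (con c-inl · a) × Real s B ρ a))
        ⊎ (Σ[ b ∈ CTm ∣ C ∣ ] (_⇝_ Rule r (con c-inr · b) × Real s C ρ b))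
      Real s (B →ᶠ C) ρ r   = (p : CTm ∣ B ∣) → Real s B ρ p → RealT s C ρ (r · p)
      Real s (∀ᶠ B) ρ r     = (m : ℕ) → RealT s B (ρ ,, numeral m) (r · numeral m)
      Real s (∃ᶠ B) ρ r     = Real s B (ρ ,, (con c-π₁ · r)) (con c-π₂ · r)

      RealT : (s : CTm StateT) → ∀ {n} (A : Fm n) → Env n → CTm ∥ A ∥ → Set
      RealT s A ρ r =
          (Σ[ r' ∈ CTm ∣ A ∣ ] (_⇝_ Rule (r · s) (con c-inl · r') × Real s A ρ r'))
        ⊎ (Σ[ e ∈ CTm ExT ] (_⇝_ Rule (r · s) (con c-inr · e) × e properlyExtends s))

    Rz : (s : CTm StateT) (A : Fm 0) → CTm ∣ A ∣ → Set
    Rz s A r = Real s A emptyEnv r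

    RzT : (s : CTm StateT) (A : Fm 0) → CTm ∥ A ∥ → Set
    RzT s A r = RealT s A emptyEnv r

  EXHyp : (CTm ExT → CTm StateT → Set) → Set
  EXHyp _properlyExtends_ = ∀ (s : CTm StateT) (e₁ e₂ : CTm ExT) →
    e₁ properlyExtends s → e₂ properlyExtends s →
    (con c-mergeEx · e₁ · e₂) properlyExtends s

-- Applied to a state s, each of unitM r, starM r p and mergeM p q reduces, after a few β-steps, to
-- a case analysis on what its arguments return at s. Every outcome either passes a realizer on or
-- propagates an exception, which properly extends s by hypothesis, or by (EX) when both arguments
-- of mergeM raise one. Besides these computations, MR3 needs ⊩ˢ to be closed under head expansion
-- (π₁ (pair a b) ⇝ a). Since the witness of an existential is the term π₁ r, expansion replaces the
-- environment of a formula by a convertible one, so ⊩ˢ must also respect convertible environments.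
module Submission where

open import Defs hiding (_⟶_; _⇝_; _≃_)
open import Data.Nat using (zero; suc)
open import Data.List using ([]; _∷_)
open import Data.Product using (_×_; _,_)
open import Data.Sum using (inj₁; inj₂)
import Data.Vec.Relation.Binary.Pointwise.Inductive as Pointwise
open import Relation.Binary.PropositionalEquality using (_≡_; refl; sym; trans; cong; cong₂)
open import Relation.Binary.Construct.Closure.ReflexiveTransitive as Star using (ε; _◅_; _◅◅_)
open import Relation.Binary.Construct.Closure.Symmetric using (fwd)
import Relation.Binary.Construct.Closure.Equivalence as EqClosure
import Relation.Binary.Reasoning.Setoid as SetoidReasoning

module SubstitutionLemmas (σ : Sig) where

  infix 4 _≗ʳ_ _≗ˢ_

  _≗ʳ_ : ∀ {Γ Δ} → Ren σ Γ Δ → Ren σ Γ Δ → Set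
  ρ ≗ʳ ρ′ = ∀ {A} (x : _∋_ σ _ A) → ρ x ≡ ρ′ x

  _≗ˢ_ : ∀ {Γ Δ} → Sub σ Γ Δ → Sub σ Γ Δ → Set
  τ ≗ˢ τ′ = ∀ {A} (x : _∋_ σ _ A) → τ x ≡ τ′ x

  rename-cong : ∀ {Γ Δ} {ρ ρ′ : Ren σ Γ Δ} → ρ ≗ʳ ρ′ → ∀ {A} (t : Tm σ Γ A) →
                rename σ ρ t ≡ rename σ ρ′ t
  rename-cong eq (var x) = cong var (eq x)
  rename-cong eq (ƛ t)   = cong ƛ_ (rename-cong (λ { Z → refl ; (S x) → cong S (eq x) }) t)
  rename-cong eq (t · u) = cong₂ _·_ (rename-cong eq t) (rename-cong eq u)
  rename-cong eq (con c) = refl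

  subst-cong : ∀ {Γ Δ} {τ τ′ : Sub σ Γ Δ} → τ ≗ˢ τ′ → ∀ {A} (t : Tm σ Γ A) →
               subst σ τ t ≡ subst σ τ′ t
  subst-cong eq (var x) = eq x
  subst-cong eq (ƛ t)   = cong ƛ_ (subst-cong (λ { Z → refl ; (S x) → cong (rename σ S) (eq x) }) t)
  subst-cong eq (t · u) = cong₂ _·_ (subst-cong eq t) (subst-cong eq u)
  subst-cong eq (con c) = refl

  rename-rename : ∀ {Γ Δ Θ} (ρ : Ren σ Γ Δ) (ρ′ : Ren σ Δ Θ) {A} (t : Tm σ Γ A) →
                  rename σ ρ′ (rename σ ρ t) ≡ rename σ (λ x → ρ′ (ρ x)) t
  rename-rename ρ ρ′ (var x) = refl
  rename-rename ρ ρ′ (ƛ t)   = cong ƛ_ (trans (rename-rename (ext σ ρ) (ext σ ρ′) t)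
                                             (rename-cong (λ { Z → refl ; (S x) → refl }) t))
  rename-rename ρ ρ′ (t · u) = cong₂ _·_ (rename-rename ρ ρ′ t) (rename-rename ρ ρ′ u)
  rename-rename ρ ρ′ (con c) = refl

  subst-rename : ∀ {Γ Δ Θ} (ρ : Ren σ Γ Δ) (τ : Sub σ Δ Θ) {A} (t : Tm σ Γ A) →
                 subst σ τ (rename σ ρ t) ≡ subst σ (λ x → τ (ρ x)) t
  subst-rename ρ τ (var x) = refl
  subst-rename ρ τ (ƛ t)   = cong ƛ_ (trans (subst-rename (ext σ ρ) (exts σ τ) t)
                                           (subst-cong (λ { Z → refl ; (S x) → refl }) t))
  subst-rename ρ τ (t · u) = cong₂ _·_ (subst-rename ρ τ t) (subst-rename ρ τ u)
  subst-rename ρ τ (con c) = refl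

  rename-subst : ∀ {Γ Δ Θ} (τ : Sub σ Γ Δ) (ρ : Ren σ Δ Θ) {A} (t : Tm σ Γ A) →
                 rename σ ρ (subst σ τ t) ≡ subst σ (λ x → rename σ ρ (τ x)) t
  rename-subst τ ρ (var x) = refl
  rename-subst τ ρ (ƛ t)   = cong ƛ_ (trans (rename-subst (exts σ τ) (ext σ ρ) t) (subst-cong exts-comm t))
    where
    exts-comm : (λ x → rename σ (ext σ ρ) (exts σ τ x)) ≗ˢ exts σ (λ x → rename σ ρ (τ x))
    exts-comm Z     = refl
    exts-comm (S x) = trans (rename-rename S (ext σ ρ) (τ x)) (sym (rename-rename ρ S (τ x)))
  rename-subst τ ρ (t · u) = cong₂ _·_ (rename-subst τ ρ t) (rename-subst τ ρ u)
  rename-subst τ ρ (con c) = refl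

  subst-subst : ∀ {Γ Δ Θ} (τ : Sub σ Γ Δ) (τ′ : Sub σ Δ Θ) {A} (t : Tm σ Γ A) →
                subst σ τ′ (subst σ τ t) ≡ subst σ (λ x → subst σ τ′ (τ x)) t
  subst-subst τ τ′ (var x) = refl
  subst-subst τ τ′ (ƛ t)   = cong ƛ_ (trans (subst-subst (exts σ τ) (exts σ τ′) t) (subst-cong exts-comm t))
    where
    exts-comm : (λ x → subst σ (exts σ τ′) (exts σ τ x)) ≗ˢ exts σ (λ x → subst σ τ′ (τ x))
    exts-comm Z     = refl
    exts-comm (S x) = trans (subst-rename S (exts σ τ′) (τ x)) (sym (rename-subst τ′ S (τ x)))
  subst-subst τ τ′ (t · u) = cong₂ _·_ (subst-subst τ τ′ t) (subst-subst τ τ′ u)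
  subst-subst τ τ′ (con c) = refl

  subst-var : ∀ {Γ A} (t : Tm σ Γ A) → subst σ var t ≡ t
  subst-var (var x) = refl
  subst-var (ƛ t)   = cong ƛ_ (trans (subst-cong (λ { Z → refl ; (S x) → refl }) t) (subst-var t))
  subst-var (t · u) = cong₂ _·_ (subst-var t) (subst-var u)
  subst-var (con c) = refl

  subst-exts-[] : ∀ {Γ A B} (τ : Sub σ Γ []) (t : Tm σ (A ∷ Γ) B) (a : CTm σ A) →
                  _[_] σ (subst σ (exts σ τ) t) a ≡ subst σ (_,,_ σ τ a) t
  subst-exts-[] τ t a = trans (subst-subst (exts σ τ) (_,,_ σ var a) t) (subst-cong exts-[] t)
    where
    exts-[] : (λ x → subst σ (_,,_ σ var a) (exts σ τ x)) ≗ˢ _,,_ σ τ a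
    exts-[] Z     = refl
    exts-[] (S x) = trans (subst-rename S (_,,_ σ var a) (τ x)) (subst-var (τ x))

module Reduction (σ : Sig) (Rule : RuleSet σ) where
  open SubstitutionLemmas σ

  infix  2 _⟶_ _⇝_ _≃_
  infixl 5 _▸_

  _⟶_ _⇝_ _≃_ : ∀ {Γ A} → Tm σ Γ A → Tm σ Γ A → Set
  _⟶_ = Defs._⟶_ σ Rule
  _⇝_ = Defs._⇝_ σ Rule
  _≃_ = Defs._≃_ σ Rule

  _▸_ : ∀ {Γ Δ B} → Sub σ Γ Δ → Tm σ Δ B → Sub σ (B ∷ Γ) Δ
  _▸_ = _,,_ σ

  ∅ : Sub σ [] []
  ∅ = emptyEnv σ

  ⇝-reflexive : ∀ {Γ A} {t u : Tm σ Γ A} → t ≡ u → t ⇝ u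
  ⇝-reflexive refl = ε

  ⇝⇒≃ : ∀ {Γ A} {t u : Tm σ Γ A} → t ⇝ u → t ≃ u
  ⇝⇒≃ = Star.map fwd

  ≃-sym : ∀ {Γ A} {t u : Tm σ Γ A} → t ≃ u → u ≃ t
  ≃-sym = EqClosure.symmetric _

  ·-congˡ-⇝ : ∀ {Γ A B} {t t′ : Tm σ Γ (A ⇒ B)} {u} → t ⇝ t′ → t · u ⇝ t′ · u
  ·-congˡ-⇝ = Star.gmap _ ξ-·₁

  ·-congʳ-⇝ : ∀ {Γ A B} {t : Tm σ Γ (A ⇒ B)} {u u′} → u ⇝ u′ → t · u ⇝ t · u′
  ·-congʳ-⇝ = Star.gmap _ ξ-·₂

  ·-cong-≃ : ∀ {Γ A B} {t t′ : Tm σ Γ (A ⇒ B)} {u u′} → t ≃ t′ → u ≃ u′ → t · u ≃ t′ · u′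
  ·-cong-≃ t≃t′ u≃u′ = EqClosure.gmap _ ξ-·₁ t≃t′ ◅◅ EqClosure.gmap _ ξ-·₂ u≃u′

  β-closed : ∀ {Γ A B} (τ : Sub σ Γ []) (t : Tm σ (A ∷ Γ) B) (a : CTm σ A) →
             subst σ τ (ƛ t) · a ⇝ subst σ (τ ▸ a) t
  β-closed τ t a = β ◅ ⇝-reflexive (subst-exts-[] τ t a)

  β¹ : ∀ {X B} (t : Tm σ (X ∷ []) B) (x : CTm σ X) → (ƛ t) · x ⇝ subst σ (∅ ▸ x) t
  β¹ t x = β ◅ ⇝-reflexive (subst-cong var▸x≗∅▸x t)
    where
    var▸x≗∅▸x : var ▸ x ≗ˢ ∅ ▸ x
    var▸x≗∅▸x Z = refl

  β² : ∀ {X Y B} (t : Tm σ (Y ∷ X ∷ []) B) (x : CTm σ X) (y : CTm σ Y) →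
       (ƛ ƛ t) · x · y ⇝ subst σ (∅ ▸ x ▸ y) t
  β² t x y = ·-congˡ-⇝ (β¹ (ƛ t) x) ◅◅ β-closed (∅ ▸ x) t y

  β³ : ∀ {X Y Z B} (t : Tm σ (Z ∷ Y ∷ X ∷ []) B) (x : CTm σ X) (y : CTm σ Y) (z : CTm σ Z) →
       (ƛ ƛ ƛ t) · x · y · z ⇝ subst σ (∅ ▸ x ▸ y ▸ z) t
  β³ t x y z = ·-congˡ-⇝ (β² (ƛ t) x y) ◅◅ β-closed (∅ ▸ x ▸ y) t z

  case-inl-⇝ : ∀ {Γ X Y Z} {t : Tm σ Γ (X ⊕ Y)} {a} {f : Tm σ Γ (X ⇒ Z)} {g : Tm σ Γ (Y ⇒ Z)} →
               t ⇝ con c-inl · a → con c-case · t · f · g ⇝ f · a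
  case-inl-⇝ t⇝ = ·-congˡ-⇝ (·-congˡ-⇝ (·-congʳ-⇝ t⇝)) ◅◅ β-inl ◅ ε

  case-inr-⇝ : ∀ {Γ X Y Z} {t : Tm σ Γ (X ⊕ Y)} {b} {f : Tm σ Γ (X ⇒ Z)} {g : Tm σ Γ (Y ⇒ Z)} →
               t ⇝ con c-inr · b → con c-case · t · f · g ⇝ g · b
  case-inr-⇝ t⇝ = ·-congˡ-⇝ (·-congˡ-⇝ (·-congʳ-⇝ t⇝)) ◅◅ β-inr ◅ ε

  unitM-⇝ : ∀ {X} (a : CTm σ X) (s : CTm σ StateT) → unitM σ · a · s ⇝ con c-inl · a
  unitM-⇝ a s = β² _ a s

  module _ {X Y} (r : CTm σ (X ⇒ Tmon σ Y)) (p : CTm σ (Tmon σ X)) (s : CTm σ StateT) where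

    starM-⇝-inl : ∀ {a} → p · s ⇝ con c-inl · a → starM σ · r · p · s ⇝ r · a · s
    starM-⇝-inl {a} p⇝ =
      β³ _ r p s ◅◅ case-inl-⇝ p⇝ ◅◅ β-closed (∅ ▸ r ▸ p ▸ s) (var (S (S (S Z))) · var Z · var (S Z)) a

    starM-⇝-inr : ∀ {e} → p · s ⇝ con c-inr · e → starM σ · r · p · s ⇝ con c-inr · e
    starM-⇝-inr p⇝ = β³ _ r p s ◅◅ case-inr-⇝ p⇝

  module _ {X Y} (p : CTm σ (Tmon σ X)) (q : CTm σ (Tmon σ Y)) (s : CTm σ StateT) where

    -- The bodies passed to β-closed are spelled out: unification cannot recover them from their substituted forms.
    private
      Branch : Type σ → Set
      Branch C = Tm σ (C ∷ StateT ∷ Tmon σ Y ∷ Tmon σ X ∷ []) ((X ⊗ Y) ⊕ ExT)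

      inl-branch : Branch X
      inl-branch = con c-case · (var (S (S Z)) · var (S Z))
                     · (ƛ (con c-inl · (con c-pair · var (S Z) · var Z))) · con c-inr

      inr-branch : Branch ExT
      inr-branch = con c-case · (var (S (S Z)) · var (S Z))
                     · (ƛ (con c-inr · var (S Z))) · (ƛ (con c-inr · (con c-mergeEx · var (S Z) · var Z)))

    mergeM-⇝-inl-inl : ∀ {a b} → p · s ⇝ con c-inl · a → q · s ⇝ con c-inl · b →
                       mergeM σ · p · q · s ⇝ con c-inl · (con c-pair · a · b)
    mergeM-⇝-inl-inl {a} {b} p⇝ q⇝ =
      β³ _ p q s ◅◅ case-inl-⇝ p⇝ ◅◅ β-closed (∅ ▸ p ▸ q ▸ s) inl-branch a
      ◅◅ case-inl-⇝ q⇝ ◅◅ β-closed (∅ ▸ p ▸ q ▸ s ▸ a) (con c-inl · (con c-pair · var (S Z) · var Z)) b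

    mergeM-⇝-inl-inr : ∀ {a e} → p · s ⇝ con c-inl · a → q · s ⇝ con c-inr · e →
                       mergeM σ · p · q · s ⇝ con c-inr · e
    mergeM-⇝-inl-inr {a} p⇝ q⇝ =
      β³ _ p q s ◅◅ case-inl-⇝ p⇝ ◅◅ β-closed (∅ ▸ p ▸ q ▸ s) inl-branch a ◅◅ case-inr-⇝ q⇝

    mergeM-⇝-inr-inl : ∀ {e b} → p · s ⇝ con c-inr · e → q · s ⇝ con c-inl · b →
                       mergeM σ · p · q · s ⇝ con c-inr · e
    mergeM-⇝-inr-inl {e} {b} p⇝ q⇝ =
      β³ _ p q s ◅◅ case-inr-⇝ p⇝ ◅◅ β-closed (∅ ▸ p ▸ q ▸ s) inr-branch e
      ◅◅ case-inl-⇝ q⇝ ◅◅ β-closed (∅ ▸ p ▸ q ▸ s ▸ e) (con c-inr · var (S Z)) b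

    mergeM-⇝-inr-inr : ∀ {e₁ e₂} → p · s ⇝ con c-inr · e₁ → q · s ⇝ con c-inr · e₂ →
                       mergeM σ · p · q · s ⇝ con c-inr · (con c-mergeEx · e₁ · e₂)
    mergeM-⇝-inr-inr {e₁} {e₂} p⇝ q⇝ =
      β³ _ p q s ◅◅ case-inr-⇝ p⇝ ◅◅ β-closed (∅ ▸ p ▸ q ▸ s) inr-branch e₁
      ◅◅ case-inr-⇝ q⇝ ◅◅ β-closed (∅ ▸ p ▸ q ▸ s ▸ e₁) (con c-inr · (con c-mergeEx · var (S Z) · var Z)) e₂

  infix 4 _≈ᵉ_

  _≈ᵉ_ : ∀ {n} → Env σ n → Env σ n → Set
  ρ ≈ᵉ ρ′ = ∀ {A} (x : _∋_ σ (NCtx σ _) A) → ρ x ≃ ρ′ x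

  ≈ᵉ-refl : ∀ {n} {ρ : Env σ n} → ρ ≈ᵉ ρ
  ≈ᵉ-refl x = ε

  ≈ᵉ-sym : ∀ {n} {ρ ρ′ : Env σ n} → ρ ≈ᵉ ρ′ → ρ′ ≈ᵉ ρ
  ≈ᵉ-sym ρ≈ρ′ x = ≃-sym (ρ≈ρ′ x)

  ≈ᵉ-▸ : ∀ {n} {ρ ρ′ : Env σ n} {a a′ : CTm σ NatT} → ρ ≈ᵉ ρ′ → a ≃ a′ → ρ ▸ a ≈ᵉ ρ′ ▸ a′
  ≈ᵉ-▸ ρ≈ρ′ a≃a′ Z     = a≃a′
  ≈ᵉ-▸ ρ≈ρ′ a≃a′ (S x) = ρ≈ρ′ x

  -- Rule need not be stable under renaming, so ≃ cannot be pushed under a binder of t.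
  -- Instead the last variable is abstracted again, turning its value into an argument of a β-redex.
  subst-resp-≈ᵉ : ∀ {n} {ρ ρ′ : Env σ n} → ρ ≈ᵉ ρ′ → ∀ {A} (t : Tm σ (NCtx σ n) A) →
                  subst σ ρ t ≃ subst σ ρ′ t
  subst-resp-≈ᵉ {zero}  ρ≈ρ′ t = ⇝⇒≃ (⇝-reflexive (subst-cong (λ ()) t))
  subst-resp-≈ᵉ {suc n} {ρ} {ρ′} ρ≈ρ′ {A} t = begin
    subst σ ρ t                      ≡⟨ subst-cong (split ρ) t ⟩
    subst σ (tail ρ ▸ ρ Z) t         ≈⟨ ≃-sym (⇝⇒≃ (β-closed (tail ρ) t (ρ Z))) ⟩
    subst σ (tail ρ) (ƛ t) · ρ Z     ≈⟨ ·-cong-≃ (subst-resp-≈ᵉ (λ x → ρ≈ρ′ (S x)) (ƛ t)) (ρ≈ρ′ Z) ⟩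
    subst σ (tail ρ′) (ƛ t) · ρ′ Z   ≈⟨ ⇝⇒≃ (β-closed (tail ρ′) t (ρ′ Z)) ⟩
    subst σ (tail ρ′ ▸ ρ′ Z) t       ≡⟨ subst-cong (split ρ′) t ⟨
    subst σ ρ′ t                     ∎
    where
    open SetoidReasoning (EqClosure.setoid (Defs._⟶_ σ Rule {[]} {A}))
    tail : Env σ (suc n) → Env σ n
    tail ρ x = ρ (S x)
    split : (ρ : Env σ (suc n)) → ρ ≗ˢ tail ρ ▸ ρ Z
    split ρ Z     = refl
    split ρ (S x) = refl

module Realizability (σ : Sig) (Rule : RuleSet σ)
                     (_properlyExtends_ : CTm σ ExT → CTm σ StateT → Set) (s : CTm σ StateT) where
  open Reduction σ Rule

  Realizes : ∀ {n} (A : Fm σ n) → Env σ n → CTm σ (∣_∣ σ A) → Set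
  Realizes = Real σ Rule _properlyExtends_ s

  RealizesT : ∀ {n} (A : Fm σ n) → Env σ n → CTm σ (∥_∥ σ A) → Set
  RealizesT = RealT σ Rule _properlyExtends_ s

  RealizesT-map : ∀ {n} {A : Fm σ n} {ρ ρ′ : Env σ n} →
                  (∀ {r} → Realizes A ρ r → Realizes A ρ′ r) → ∀ {r} → RealizesT A ρ r → RealizesT A ρ′ r
  RealizesT-map f (inj₁ (r′ , ⇝r′ , r′⊩A)) = inj₁ (r′ , ⇝r′ , f r′⊩A)
  RealizesT-map f (inj₂ raise)              = inj₂ raise

  Realizes-resp-≈ᵉ : ∀ {n} (A : Fm σ n) {ρ ρ′ : Env σ n} → ρ ≈ᵉ ρ′ →
                     ∀ {r} → Realizes A ρ r → Realizes A ρ′ r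
  Realizes-resp-≈ᵉ ⊥ᶠ          ρ≈ρ′ (_ , ())
  Realizes-resp-≈ᵉ (atom P ts) ρ≈ρ′ (r⇝ , ns , ts≃ns , Pns) =
    r⇝ , ns , Pointwise.map (λ {t} t≃m → ≃-sym (subst-resp-≈ᵉ ρ≈ρ′ t) ◅◅ t≃m) ts≃ns , Pns
  Realizes-resp-≈ᵉ (B ∧ᶠ C)    ρ≈ρ′ (b , c) = Realizes-resp-≈ᵉ B ρ≈ρ′ b , Realizes-resp-≈ᵉ C ρ≈ρ′ c
  Realizes-resp-≈ᵉ (B ∨ᶠ C)    ρ≈ρ′ (inj₁ (b , r⇝ , b⊩B)) = inj₁ (b , r⇝ , Realizes-resp-≈ᵉ B ρ≈ρ′ b⊩B)
  Realizes-resp-≈ᵉ (B ∨ᶠ C)    ρ≈ρ′ (inj₂ (c , r⇝ , c⊩C)) = inj₂ (c , r⇝ , Realizes-resp-≈ᵉ C ρ≈ρ′ c⊩C)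
  Realizes-resp-≈ᵉ (B →ᶠ C)    ρ≈ρ′ f p b =
    RealizesT-map (Realizes-resp-≈ᵉ C ρ≈ρ′) (f p (Realizes-resp-≈ᵉ B (≈ᵉ-sym ρ≈ρ′) b))
  Realizes-resp-≈ᵉ (∀ᶠ B)      ρ≈ρ′ f m = RealizesT-map (Realizes-resp-≈ᵉ B (≈ᵉ-▸ ρ≈ρ′ ε)) (f m)
  Realizes-resp-≈ᵉ (∃ᶠ B)      ρ≈ρ′ b   = Realizes-resp-≈ᵉ B (≈ᵉ-▸ ρ≈ρ′ ε) b

  RealizesT-expand : ∀ {n} (A : Fm σ n) {ρ : Env σ n} {r r′} →
                     r · s ⇝ r′ · s → RealizesT A ρ r′ → RealizesT A ρ r
  RealizesT-expand A r⇝r′ (inj₁ (a , r′⇝ , a⊩A))   = inj₁ (a , r⇝r′ ◅◅ r′⇝ , a⊩A)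
  RealizesT-expand A r⇝r′ (inj₂ (e , r′⇝ , e⊐s)) = inj₂ (e , r⇝r′ ◅◅ r′⇝ , e⊐s)

  Realizes-expand : ∀ {n} (A : Fm σ n) {ρ : Env σ n} {r r′} → r ⇝ r′ → Realizes A ρ r′ → Realizes A ρ r
  Realizes-expand ⊥ᶠ          r⇝r′ (_ , ())
  Realizes-expand (atom P ts) r⇝r′ (r′⇝ , P-true) = r⇝r′ ◅◅ r′⇝ , P-true
  Realizes-expand (B ∧ᶠ C)    r⇝r′ (b , c) =
    Realizes-expand B (·-congʳ-⇝ r⇝r′) b , Realizes-expand C (·-congʳ-⇝ r⇝r′) c
  Realizes-expand (B ∨ᶠ C)    r⇝r′ (inj₁ (b , r′⇝ , b⊩B)) = inj₁ (b , r⇝r′ ◅◅ r′⇝ , b⊩B)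
  Realizes-expand (B ∨ᶠ C)    r⇝r′ (inj₂ (c , r′⇝ , c⊩C)) = inj₂ (c , r⇝r′ ◅◅ r′⇝ , c⊩C)
  Realizes-expand (B →ᶠ C)    r⇝r′ f p b = RealizesT-expand C (·-congˡ-⇝ (·-congˡ-⇝ r⇝r′)) (f p b)
  Realizes-expand (∀ᶠ B)      r⇝r′ f m   = RealizesT-expand B (·-congˡ-⇝ (·-congˡ-⇝ r⇝r′)) (f m)
  Realizes-expand (∃ᶠ B) {ρ} r⇝r′ b =
    Realizes-expand B (·-congʳ-⇝ r⇝r′)
      (Realizes-resp-≈ᵉ B (≈ᵉ-▸ (≈ᵉ-refl {ρ = ρ}) (≃-sym (⇝⇒≃ (·-congʳ-⇝ r⇝r′)))) b)

  unitM-realizes : ∀ {n} (A : Fm σ n) {ρ : Env σ n} {r} → Realizes A ρ r → RealizesT A ρ (unitM σ · r)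
  unitM-realizes A {r = r} r⊩A = inj₁ (r , unitM-⇝ r s , r⊩A)

  starM-realizes : ∀ {n} (B C : Fm σ n) {ρ : Env σ n} {r p} → Realizes (B →ᶠ C) ρ r →
                   RealizesT B ρ p → RealizesT C ρ (starM σ · r · p)
  starM-realizes B C {r = r} {p} f (inj₁ (a , p⇝ , a⊩B)) =
    RealizesT-expand C (starM-⇝-inl r p s p⇝) (f a a⊩B)
  starM-realizes B C {r = r} {p} f (inj₂ (e , p⇝ , e⊐s)) = inj₂ (e , starM-⇝-inr r p s p⇝ , e⊐s)

  mergeM-realizes : EXHyp σ _properlyExtends_ →
                    ∀ {n} (B C : Fm σ n) {ρ : Env σ n} {p q} → RealizesT B ρ p → RealizesT C ρ q →
                    RealizesT (B ∧ᶠ C) ρ (mergeM σ · p · q)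
  mergeM-realizes ex B C {p = p} {q} (inj₁ (a , p⇝ , a⊩B)) (inj₁ (b , q⇝ , b⊩C)) =
    inj₁ (con c-pair · a · b , mergeM-⇝-inl-inl p q s p⇝ q⇝ ,
          Realizes-expand B (β-π₁ ◅ ε) a⊩B , Realizes-expand C (β-π₂ ◅ ε) b⊩C)
  mergeM-realizes ex B C {p = p} {q} (inj₁ (a , p⇝ , _)) (inj₂ (e , q⇝ , e⊐s)) =
    inj₂ (e , mergeM-⇝-inl-inr p q s p⇝ q⇝ , e⊐s)
  mergeM-realizes ex B C {p = p} {q} (inj₂ (e , p⇝ , e⊐s)) (inj₁ (b , q⇝ , _)) =
    inj₂ (e , mergeM-⇝-inr-inl p q s p⇝ q⇝ , e⊐s)
  mergeM-realizes ex B C {p = p} {q} (inj₂ (e₁ , p⇝ , e₁⊐s)) (inj₂ (e₂ , q⇝ , e₂⊐s)) =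
    inj₂ (con c-mergeEx · e₁ · e₂ , mergeM-⇝-inr-inr p q s p⇝ q⇝ , ex s e₁ e₂ e₁⊐s e₂⊐s)

mainTheorem2 : (σ : Sig) (Rule : RuleSet σ)
  (properlyExtends : CTm σ ExT → CTm σ StateT → Set) →
  EXHyp σ properlyExtends →
  (s : CTm σ StateT) →
    -- (MR1)
    ((A : Fm σ 0) (r : CTm σ (∣_∣ σ A)) →
      Rz σ Rule properlyExtends s A r →
      RzT σ Rule properlyExtends s A (unitM σ · r))
  × -- (MR2)
    ((B C : Fm σ 0) (r : CTm σ (∣_∣ σ (B →ᶠ C))) →
      Rz σ Rule properlyExtends s (B →ᶠ C) r →
      (p : CTm σ (∥_∥ σ B)) →
      RzT σ Rule properlyExtends s B p →
      RzT σ Rule properlyExtends s C (starM σ · r · p))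
  × -- (MR3)
    ((B C : Fm σ 0) (p : CTm σ (∥_∥ σ B)) (q : CTm σ (∥_∥ σ C)) →
      RzT σ Rule properlyExtends s B p →
      RzT σ Rule properlyExtends s C q →
      RzT σ Rule properlyExtends s (B ∧ᶠ C) (mergeM σ · p · q))
mainTheorem2 σ Rule properlyExtends ex s =
    (λ A r → unitM-realizes A)
  , (λ B C r f p → starM-realizes B C f)
  , (λ B C p q → mergeM-realizes ex B C)
  where open Realizability σ Rule properlyExtends s
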